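{- The one-way infinite ray $R$ (vertex set $\mathbb{N}_0$, edges $\{i,i+1\}$) and the two-way infinite double ray $Z$ (vertex set $\mathbb{Z}$, edges $\{i,i+1\}$) satisfy $D_e(R) = D_e(Z) = 2$.
   Context: An endomorphism of a simple graph $G=(V,E)$ is a map $\phi: V\to V$ such that $\phi(u)\phi(v)\in E$ whenever $uv\in E$. A labeling $c$ of $V$ is preserved by $\phi$ if $c(\phi(v))=c(v)$ for all $v$. The endomorphism distinguishing number $D_e(G)$ is the least cardinal $d$ such that $G$ has a labeling with $d$ labels preserved only by the identity endomorphism. -}

module Defs where

open import Level using (Level; _⊔_; suc)
open import Data.Nat as ℕ using (ℕ; _<_)
open import Data.Integer as ℤ using (ℤ)
open import Data.Fin using (Fin)
open import Data.Product using (Σ; _×_; ∃)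
open import Data.Sum using (_⊎_)
open import Relation.Binary.PropositionalEquality using (_≡_)
open import Relation.Nullary using (¬_)

record Graph : Set₁ where
  field
    V   : Set
    E   : V → V → Set
    E-sym : ∀ {u v} → E u v → E v u
    E-irr : ∀ {v} → ¬ E v v
open Graph public

IsEndomorphism : (G : Graph) → (V G → V G) → Set
IsEndomorphism G φ = ∀ u v → E G u v → E G (φ u) (φ v)

Preserves : {G : Graph} {L : Set} → (V G → L) → (V G → V G) → Set
Preserves {G} c φ = ∀ v → c (φ v) ≡ c v

EndoDistinguishing : (G : Graph) {L : Set} → (V G → L) → Set
EndoDistinguishing G c =
  ∀ (φ : V G → V G) → IsEndomorphism G φ → Preserves {G} c φ → ∀ v → φ v ≡ v

EndoDistNumberIs : Graph → ℕ → Set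
EndoDistNumberIs G d =
  Σ (V G → Fin d) (λ c → EndoDistinguishing G c)
  × (∀ k → k < d → (c : V G → Fin k) → ¬ EndoDistinguishing G c)

RayAdj : ℕ → ℕ → Set
RayAdj i j = ℕ.suc i ≡ j ⊎ ℕ.suc j ≡ i

ZAdj : ℤ → ℤ → Set
ZAdj i j = i ℤ.+ ℤ.+ 1 ≡ j ⊎ j ℤ.+ ℤ.+ 1 ≡ i

private
  open import Relation.Binary.PropositionalEquality using (refl; cong; trans; sym)
  open import Data.Sum using (inj₁; inj₂)
  import Data.Nat.Properties as ℕP
  import Data.Integer.Properties as ℤP

  ray-sym : ∀ {u v} → RayAdj u v → RayAdj v u
  ray-sym (inj₁ p) = inj₂ p
  ray-sym (inj₂ p) = inj₁ p

  ray-irr : ∀ {v} → ¬ RayAdj v v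
  ray-irr (inj₁ p) = ℕP.1+n≢n p
  ray-irr (inj₂ p) = ℕP.1+n≢n p

  z-step : ∀ i → ¬ (i ℤ.+ ℤ.+ 1 ≡ i)
  z-step i p with trans (sym (lhs)) (cong (λ x → (ℤ.- i) ℤ.+ x) p)
    where
    lhs : ℤ.- i ℤ.+ (i ℤ.+ ℤ.+ 1) ≡ ℤ.+ 1
    lhs = trans (sym (ℤP.+-assoc (ℤ.- i) i (ℤ.+ 1)))
                (cong (ℤ._+ ℤ.+ 1) (ℤP.+-inverseˡ i))
  ... | q with trans q (ℤP.+-inverseˡ i)
  ... | ()

  z-sym : ∀ {u v} → ZAdj u v → ZAdj v u
  z-sym (inj₁ p) = inj₂ p
  z-sym (inj₂ p) = inj₁ p

  z-irr : ∀ {v} → ¬ ZAdj v v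
  z-irr {v} (inj₁ p) = z-step v p
  z-irr {v} (inj₂ p) = z-step v p

Ray : Graph
Ray = record { V = ℕ ; E = RayAdj ; E-sym = ray-sym ; E-irr = ray-irr }

DoubleRay : Graph
DoubleRay = record { V = ℤ ; E = ZAdj ; E-sym = z-sym ; E-irr = z-irr }

-- Endomorphisms of the ray and of the double ray are walks: consecutive
-- vertices go to adjacent vertices.  Label the ray by blocks, block j being two markers
-- followed by a gap of 2(j+1) non-markers.  A label-preserving walk that stands on the
-- upper marker of a pair and moves up must cross the whole gap: it cannot step back onto
-- the pair, and after an odd number of steps it cannot be back on the marker it left.  So
-- the gaps it meets in the image are at most as long as the ones it reads, and the first
-- gap, the shortest one, pins the first pair to itself; from then on every pair is fixed,
-- and a walk of length n between fixed points n apart is the identity in between.  On ℤ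
-- the negative side gets the longer gaps 6, 8, …, which rules out the first block being
-- mapped reflected, and reflecting through 1/2 turns the negative half into another ray.
-- One label never suffices, since translation is a non-identity endomorphism.
module Submission where

open import Defs
open import Data.Nat as ℕ using (ℕ; zero; suc; _≤_; _<_; z≤n; s≤s; s≤s⁻¹)
import Data.Nat.Properties as ℕP
open import Data.Integer as ℤ using (ℤ; +_; -[1+_])
import Data.Integer.Properties as ℤP
open import Data.Bool using (Bool; true; false)
open import Data.Fin using (Fin)
open import Data.Fin.Properties using (2↔Bool)
open import Data.Product using (_×_; _,_; proj₁; proj₂; ∃-syntax; ∃₂)
open import Data.Sum using (_⊎_; inj₁; inj₂)
open import Data.Empty using (⊥; ⊥-elim)
open import Function using (_∘_; Inverse)
open import Relation.Nullary using (¬_)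
open import Relation.Binary.PropositionalEquality
open import Algebra.Bundles using (AbelianGroup)
open import Algebra.Properties.Group (AbelianGroup.group ℤP.+-0-abelianGroup)
  using (∙-cancelˡ; ∙-cancelʳ)
open import Data.Integer.Tactic.RingSolver using (solve-∀)
import Data.Nat.Tactic.RingSolver as ℕSolver

Walk : (ℕ → ℤ) → Set
Walk w = ∀ i → ZAdj (w i) (w (suc i))

Follows : (ℤ → Bool) → (ℕ → ℤ) → (ℕ → Bool) → Set
Follows μ w ℓ = ∀ n → μ (w n) ≡ ℓ n

+-suc-step : ∀ x n → (x ℤ.+ + n) ℤ.+ + 1 ≡ x ℤ.+ + suc n
+-suc-step x n = trans (ℤP.+-assoc x (+ n) (+ 1)) (cong (λ m → x ℤ.+ + m) (ℕP.+-comm n 1))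

reflect-step : ∀ c x y → x ℤ.+ + 1 ≡ y → (c ℤ.- y) ℤ.+ + 1 ≡ c ℤ.- x
reflect-step c x y refl = reflected-successor c x
  where
  reflected-successor : ∀ c x → (c ℤ.- (x ℤ.+ + 1)) ℤ.+ + 1 ≡ c ℤ.- x
  reflected-successor = solve-∀

reflect-involutive : ∀ c x → c ℤ.- (c ℤ.- x) ≡ x
reflect-involutive = solve-∀

walk-shift : ∀ {w} → Walk w → ∀ s → Walk (λ i → w (i ℕ.+ s))
walk-shift W s i = W (i ℕ.+ s)

walk-reflect : ∀ {w} → Walk w → ∀ c → Walk (λ i → c ℤ.- w i)
walk-reflect {w} W c i with W i
... | inj₁ up   = inj₂ (reflect-step c (w i) (w (suc i)) up)
... | inj₂ down = inj₁ (reflect-step c (w (suc i)) (w i) down)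

displacement : ∀ {w} → Walk w → ∀ d →
  ∃₂ λ up down → up ℕ.+ down ≡ d × w 0 ℤ.+ + up ≡ w d ℤ.+ + down
displacement W zero = 0 , 0 , refl , refl
displacement {w} W (suc d) with displacement W d | W d
... | up , down , count , eq | inj₁ step = suc up , down , cong suc count , (begin
  w 0 ℤ.+ + suc up                ≡⟨ sym (+-suc-step (w 0) up) ⟩
  (w 0 ℤ.+ + up) ℤ.+ + 1          ≡⟨ cong (ℤ._+ + 1) eq ⟩
  (w d ℤ.+ + down) ℤ.+ + 1        ≡⟨ swap (w d) (+ down) (+ 1) ⟩
  (w d ℤ.+ + 1) ℤ.+ + down        ≡⟨ cong (ℤ._+ + down) step ⟩
  w (suc d) ℤ.+ + down            ∎)
  where
  open ≡-Reasoning
  swap : ∀ x a b → (x ℤ.+ a) ℤ.+ b ≡ (x ℤ.+ b) ℤ.+ a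
  swap = solve-∀
... | up , down , count , eq | inj₂ step =
  up , suc down , trans (ℕP.+-suc up down) (cong suc count) , (begin
  w 0 ℤ.+ + up                        ≡⟨ eq ⟩
  w d ℤ.+ + down                      ≡⟨ cong (ℤ._+ + down) (sym step) ⟩
  (w (suc d) ℤ.+ + 1) ℤ.+ + down      ≡⟨ ℤP.+-assoc (w (suc d)) (+ 1) (+ down) ⟩
  w (suc d) ℤ.+ + suc down            ∎)
  where open ≡-Reasoning

walk-reach : ∀ {w} → Walk w → ∀ n m → w n ≡ w 0 ℤ.+ + m → m ≤ n
walk-reach {w} W n m reached with displacement W n
... | up , down , count , eq = subst (m ≤_) count (ℕP.≤-trans (ℕP.m≤m+n m down)
  (ℕP.≤-trans (ℕP.≤-reflexive up≡) (ℕP.m≤m+n up down)))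
  where
  up≡ : m ℕ.+ down ≡ up
  up≡ = ℤP.+-injective (∙-cancelˡ (w 0) _ _ (sym (begin
    w 0 ℤ.+ + up                   ≡⟨ eq ⟩
    w n ℤ.+ + down                 ≡⟨ cong (ℤ._+ + down) reached ⟩
    (w 0 ℤ.+ + m) ℤ.+ + down       ≡⟨ ℤP.+-assoc (w 0) (+ m) (+ down) ⟩
    w 0 ℤ.+ + (m ℕ.+ down)         ∎)))
    where open ≡-Reasoning

walk-odd-length : ∀ {w} → Walk w → ∀ h → w (suc (2 ℕ.* h)) ≢ w 0
walk-odd-length {w} W h closed with displacement W (suc (2 ℕ.* h))
... | up , down , count , eq = ℕP.even≢odd up h (trans (cong (up ℕ.+_) (trans (ℕP.+-identityʳ up) up≡down)) count)
  where
  up≡down : up ≡ down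
  up≡down = ℤP.+-injective (∙-cancelˡ (w 0) _ _ (trans eq (cong (ℤ._+ + down) closed)))

no-down-steps : ∀ {S U D} → U ℕ.+ D ≡ S → U ≡ S ℕ.+ D → D ≡ 0
no-down-steps {S} {U} {D} total net = ℕP.m+n≡0⇒m≡0 D (ℕP.+-cancelˡ-≡ S (D ℕ.+ D) 0 (begin
  S ℕ.+ (D ℕ.+ D)     ≡⟨ sym (ℕP.+-assoc S D D) ⟩
  (S ℕ.+ D) ℕ.+ D     ≡⟨ cong (ℕ._+ D) (sym net) ⟩
  U ℕ.+ D             ≡⟨ total ⟩
  S                   ≡⟨ sym (ℕP.+-identityʳ S) ⟩
  S ℕ.+ 0             ∎))
  where open ≡-Reasoning

walk-tight : ∀ {w} → Walk w → w 0 ≡ + 0 → ∀ {S} → w S ≡ + S → ∀ {n} → n ≤ S → w n ≡ + n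
walk-tight {w} W start {S} end {n} n≤S
  with displacement W n | displacement (walk-shift W n) (S ℕ.∸ n)
... | up₁ , down₁ , count₁ , eq₁ | up₂ , down₂ , count₂ , eq₂ = begin
  w n                    ≡⟨ sym (ℤP.+-identityʳ (w n)) ⟩
  w n ℤ.+ + 0            ≡⟨ cong (λ m → w n ℤ.+ + m) (sym down₁≡0) ⟩
  w n ℤ.+ + down₁        ≡⟨ sym eq₁′ ⟩
  + up₁                  ≡⟨ cong +_ up₁≡n ⟩
  + n                    ∎
  where
  open ≡-Reasoning
  eq₁′ : + up₁ ≡ w n ℤ.+ + down₁
  eq₁′ = trans (cong (ℤ._+ + up₁) (sym start)) eq₁
  eq₂′ : w n ℤ.+ + up₂ ≡ + S ℤ.+ + down₂
  eq₂′ = trans eq₂ (cong (ℤ._+ + down₂) (trans (cong w (ℕP.m∸n+n≡m n≤S)) end))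
  total : (up₁ ℕ.+ up₂) ℕ.+ (down₁ ℕ.+ down₂) ≡ S
  total = trans (regroup up₁ up₂ down₁ down₂) (trans (cong₂ ℕ._+_ count₁ count₂) (ℕP.m+[n∸m]≡n n≤S))
    where
    regroup : ∀ u v a b → (u ℕ.+ v) ℕ.+ (a ℕ.+ b) ≡ (u ℕ.+ a) ℕ.+ (v ℕ.+ b)
    regroup = ℕSolver.solve-∀
  net : up₁ ℕ.+ up₂ ≡ S ℕ.+ (down₁ ℕ.+ down₂)
  net = ℤP.+-injective (begin
    + up₁ ℤ.+ + up₂                  ≡⟨ cong (ℤ._+ + up₂) eq₁′ ⟩
    (w n ℤ.+ + down₁) ℤ.+ + up₂      ≡⟨ regroup (w n) (+ down₁) (+ up₂) ⟩
    (w n ℤ.+ + up₂) ℤ.+ + down₁      ≡⟨ cong (ℤ._+ + down₁) eq₂′ ⟩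
    (+ S ℤ.+ + down₂) ℤ.+ + down₁    ≡⟨ regroup′ (+ S) (+ down₂) (+ down₁) ⟩
    + S ℤ.+ (+ down₁ ℤ.+ + down₂)    ∎)
    where
    regroup : ∀ x a b → (x ℤ.+ a) ℤ.+ b ≡ (x ℤ.+ b) ℤ.+ a
    regroup = solve-∀
    regroup′ : ∀ x a b → (x ℤ.+ a) ℤ.+ b ≡ x ℤ.+ (b ℤ.+ a)
    regroup′ = solve-∀
  down₁≡0 : down₁ ≡ 0
  down₁≡0 = ℕP.m+n≡0⇒m≡0 down₁ (no-down-steps total net)
  up₁≡n : up₁ ≡ n
  up₁≡n = trans (sym (ℕP.+-identityʳ up₁)) (trans (cong (up₁ ℕ.+_) (sym down₁≡0)) count₁)

Gap : (ℤ → Bool) → ℤ → ℕ → Set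
Gap μ x d = μ x ≡ true × (∀ i → i < d → μ (x ℤ.+ + suc i) ≡ false) × μ (x ℤ.+ + suc d) ≡ true

forced-up : ∀ {μ : ℤ → Bool} {p y z} → ZAdj y z → p ℤ.+ + 1 ≡ y → μ p ≢ μ z → z ≡ y ℤ.+ + 1
forced-up (inj₁ up) _ _ = sym up
forced-up {μ} {p} {y} {z} (inj₂ down) below differ =
  ⊥-elim (differ (cong μ (∙-cancelʳ (+ 1) p z (trans below (sym down)))))

neighbours : ∀ x n {y z} → ZAdj y z → y ≡ x ℤ.+ + suc n → z ≡ x ℤ.+ + suc (suc n) ⊎ z ≡ x ℤ.+ + n
neighbours x n (inj₁ up) refl = inj₁ (trans (sym up) (+-suc-step x (suc n)))
neighbours x n {z = z} (inj₂ down) refl =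
  inj₂ (∙-cancelʳ (+ 1) z (x ℤ.+ + n) (trans down (sym (+-suc-step x n))))

marker≢non-marker : ∀ {b : Bool} → b ≡ true → b ≡ false → ⊥
marker≢non-marker refl ()

-- While on non-markers the walk stays strictly inside the gap above x, x being a marker;
-- so the marker it finally reaches is x or the end of the gap, and x is excluded by parity.
crossing : ∀ {μ w x d} h → Walk w → Gap μ x d → w 0 ≡ x → w 1 ≡ x ℤ.+ + 1 →
  (∀ i → i < 2 ℕ.* suc h → μ (w (suc i)) ≡ false) → μ (w (suc (2 ℕ.* suc h))) ≡ true →
  w (suc (2 ℕ.* suc h)) ≡ x ℤ.+ + suc d
crossing {μ} {w} {x} {d} h W (at-x , inside , at-end) start first off on =
  exit (stays L′ (ℕP.n<1+n L′))
  where
  L′ : ℕ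
  L′ = ℕ.pred (2 ℕ.* suc h)
  at-x′ : μ (x ℤ.+ + 0) ≡ true
  at-x′ = trans (cong μ (ℤP.+-identityʳ x)) at-x
  positive : 0 < d
  positive = ℕP.n≢0⇒n>0 λ { refl → marker≢non-marker (trans (cong μ first) at-end) (off 0 (s≤s z≤n)) }
  stays : ∀ i → i < suc L′ → ∃[ e ] e < d × w (suc i) ≡ x ℤ.+ + suc e
  stays zero _ = 0 , positive , first
  stays (suc i) lt with stays i (ℕP.<-trans (ℕP.n<1+n i) lt)
  ... | e , e<d , at with neighbours x e (W (suc i)) at
  ...   | inj₁ up with ℕP.m≤n⇒m<n∨m≡n e<d
  ...     | inj₁ se<d = suc e , se<d , up
  ...     | inj₂ refl = ⊥-elim (marker≢non-marker (trans (cong μ up) at-end) (off (suc i) lt))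
  stays (suc i) lt | zero , _ , _ | inj₂ down =
    ⊥-elim (marker≢non-marker (trans (cong μ down) at-x′) (off (suc i) lt))
  stays (suc i) lt | suc e , e<d , _ | inj₂ down = e , ℕP.<-trans (ℕP.n<1+n e) e<d , down
  exit : (∃[ e ] e < d × w (suc L′) ≡ x ℤ.+ + suc e) → w (suc (suc L′)) ≡ x ℤ.+ + suc d
  exit (e , e<d , at) with neighbours x e (W (suc L′)) at
  ... | inj₁ up with ℕP.m≤n⇒m<n∨m≡n e<d
  ...   | inj₁ se<d = ⊥-elim (marker≢non-marker (trans (cong μ (sym up)) on) (inside (suc e) se<d))
  ...   | inj₂ refl = up
  exit (zero , _ , _) | inj₂ down =
    ⊥-elim (walk-odd-length W (suc h) (trans down (trans (ℤP.+-identityʳ x) (sym start))))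
  exit (suc e , e<d , _) | inj₂ down =
    ⊥-elim (marker≢non-marker (trans (cong μ (sym down)) on) (inside e (ℕP.<-trans (ℕP.n<1+n e) e<d)))

gap-reflect : ∀ {μ ν x d} c → (∀ z → ν z ≡ μ (c ℤ.- z)) → Gap μ x d →
  Gap ν (c ℤ.- (x ℤ.+ + suc d)) d
gap-reflect {μ} {ν} {x} {d} c ν≡ (at-x , inside , at-end) =
  trans (ν≡ _) (trans (cong μ (reflect-involutive c _)) at-end) ,
  (λ i i<d → trans (ν≡ _) (mirrored i i<d)) ,
  trans (ν≡ _) (trans (cong μ (back c x (+ suc d))) at-x)
  where
  back : ∀ c x s → c ℤ.- ((c ℤ.- (x ℤ.+ s)) ℤ.+ s) ≡ x
  back = solve-∀
  mirrored : ∀ i → i < d → μ (c ℤ.- ((c ℤ.- (x ℤ.+ + suc d)) ℤ.+ + suc i)) ≡ false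
  mirrored i i<d with ℕP.m≤n⇒∃[o]m+o≡n i<d
  ... | r , refl = trans (cong μ (swap c x (+ i) (+ r))) (inside r (ℕP.m<n+m r (s≤s z≤n)))
    where
    swap : ∀ c x i r → c ℤ.- ((c ℤ.- (x ℤ.+ (+ 1 ℤ.+ (+ 1 ℤ.+ (i ℤ.+ r))))) ℤ.+ (+ 1 ℤ.+ i))
                       ≡ x ℤ.+ (+ 1 ℤ.+ r)
    swap = solve-∀

gap : ℕ → ℕ
gap k = 2 ℕ.* suc k

-- blocks k is the ray labelling made of the blocks k, k+1, …, where block j is a pair
-- of markers (true) followed by gap j non-markers; gapRest k r n reads position n
-- after the pair of block k when r of its non-markers are still to come.  Block k + j
-- starts at position blockStart k j.
mutual
  blocks : ℕ → ℕ → Bool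
  blocks k zero = true
  blocks k (suc zero) = true
  blocks k (suc (suc n)) = gapRest k (gap k) n

  gapRest : ℕ → ℕ → ℕ → Bool
  gapRest k zero n = blocks (suc k) n
  gapRest k (suc r) zero = false
  gapRest k (suc r) (suc n) = gapRest k r n

blockStart : ℕ → ℕ → ℕ
blockStart k zero = 0
blockStart k (suc j) = blockStart k j ℕ.+ suc (suc (gap (k ℕ.+ j)))

gapRest-false : ∀ k r i → i < r → gapRest k r i ≡ false
gapRest-false k (suc r) zero _ = refl
gapRest-false k (suc r) (suc i) i<r = gapRest-false k r i (s≤s⁻¹ i<r)

gapRest-skip : ∀ k r n → gapRest k r (r ℕ.+ n) ≡ blocks (suc k) n
gapRest-skip k zero n = refl
gapRest-skip k (suc r) n = gapRest-skip k r n

blocks-gap : ∀ k i → i < gap k → blocks k (suc (suc i)) ≡ false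
blocks-gap k = gapRest-false k (gap k)

blocks-next : ∀ k n → blocks k (suc (suc (gap k ℕ.+ n))) ≡ blocks (suc k) n
blocks-next k = gapRest-skip k (gap k)

blocks-next-pair : ∀ k → blocks k (suc (suc (gap k))) ≡ true × blocks k (suc (suc (suc (gap k)))) ≡ true
blocks-next-pair k =
  trans (cong (blocks k ∘ suc ∘ suc) (sym (ℕP.+-identityʳ (gap k)))) (blocks-next k 0) ,
  trans (cong (blocks k ∘ suc ∘ suc) (ℕP.+-comm 1 (gap k))) (blocks-next k 1)

blocks-shift : ∀ k j o → blocks k (blockStart k j ℕ.+ o) ≡ blocks (k ℕ.+ j) o
blocks-shift k zero o = cong (λ m → blocks m o) (sym (ℕP.+-identityʳ k))
blocks-shift k (suc j) o = begin
  blocks k ((blockStart k j ℕ.+ suc (suc g)) ℕ.+ o)   ≡⟨ cong (blocks k) (ℕP.+-assoc (blockStart k j) _ o) ⟩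
  blocks k (blockStart k j ℕ.+ suc (suc (g ℕ.+ o)))   ≡⟨ blocks-shift k j _ ⟩
  blocks (k ℕ.+ j) (suc (suc (g ℕ.+ o)))              ≡⟨ blocks-next (k ℕ.+ j) o ⟩
  blocks (suc (k ℕ.+ j)) o                             ≡⟨ cong (λ m → blocks m o) (sym (ℕP.+-suc k j)) ⟩
  blocks (k ℕ.+ suc j) o                               ∎
  where
  open ≡-Reasoning
  g : ℕ
  g = gap (k ℕ.+ j)

blockStart-first : ∀ k j → blockStart k (suc j) ≡ suc (suc (gap k ℕ.+ blockStart (suc k) j))
blockStart-first k zero = cong (suc ∘ suc) (trans (cong gap (ℕP.+-identityʳ k)) (sym (ℕP.+-identityʳ (gap k))))
blockStart-first k (suc j) = begin
  blockStart k (suc j) ℕ.+ suc (suc (gap (k ℕ.+ suc j)))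
    ≡⟨ cong₂ ℕ._+_ (blockStart-first k j) (cong (suc ∘ suc ∘ gap) (ℕP.+-suc k j)) ⟩
  suc (suc (gap k ℕ.+ blockStart (suc k) j)) ℕ.+ suc (suc (gap (suc k ℕ.+ j)))
    ≡⟨ cong (suc ∘ suc) (ℕP.+-assoc (gap k) _ _) ⟩
  suc (suc (gap k ℕ.+ blockStart (suc k) (suc j)))   ∎
  where open ≡-Reasoning

mutual
  blocks-pair : ∀ k n → blocks k n ≡ true → blocks k (suc n) ≡ true → ∃[ j ] n ≡ blockStart k j
  blocks-pair k zero _ _ = 0 , refl
  blocks-pair k (suc zero) _ ()
  blocks-pair k (suc (suc n)) p q with gapRest-pair k (gap k) n p q
  ... | j , refl = suc j , sym (blockStart-first k j)

  gapRest-pair : ∀ k r n → gapRest k r n ≡ true → gapRest k r (suc n) ≡ true →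
    ∃[ j ] n ≡ r ℕ.+ blockStart (suc k) j
  gapRest-pair k zero n p q = blocks-pair (suc k) n p q
  gapRest-pair k (suc r) zero () _
  gapRest-pair k (suc r) (suc n) p q with gapRest-pair k r n p q
  ... | j , refl = j , refl

j≤blockStart : ∀ k j → j ≤ blockStart k j
j≤blockStart k zero = z≤n
j≤blockStart k (suc j) = ℕP.≤-trans (s≤s (j≤blockStart k j)) (ℕP.m<m+n (blockStart k j) (s≤s z≤n))

gap-cancel : ∀ {m n} → gap m ≤ gap n → m ≤ n
gap-cancel gm≤gn = s≤s⁻¹ (ℕP.*-cancelˡ-≤ 2 gm≤gn)

gap-after-pair : ∀ {μ} k → Follows μ +_ (blocks k) → ∀ j →
  Gap μ (+ (blockStart k j ℕ.+ 1)) (gap (k ℕ.+ j))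
gap-after-pair {μ} k reads j =
  at 1 ,
  (λ i i<g → trans (cong (μ ∘ +_) (ℕP.+-assoc s 1 (suc i)))
                (trans (at (suc (suc i))) (blocks-gap (k ℕ.+ j) i i<g))) ,
  trans (cong (μ ∘ +_) (ℕP.+-assoc s 1 _)) (trans (at _) (proj₁ (blocks-next-pair (k ℕ.+ j))))
  where
  s : ℕ
  s = blockStart k j
  at : ∀ o → μ (+ (s ℕ.+ o)) ≡ blocks (k ℕ.+ j) o
  at o = trans (reads (s ℕ.+ o)) (blocks-shift k j o)

block-step : ∀ {μ w} k {d} → Walk w → Follows μ w (blocks k) → w 1 ≡ w 0 ℤ.+ + 1 → Gap μ (w 1) d →
  d ≤ gap k × w (suc (suc (gap k))) ≡ w 1 ℤ.+ + suc d
            × w (suc (suc (suc (gap k)))) ≡ w (suc (suc (gap k))) ℤ.+ + 1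
block-step {μ} {w} k {d} W reads second gp =
  s≤s⁻¹ (walk-reach (walk-shift W 1) (suc (gap k)) (suc d) lands′) , lands , enter gp lands
  where
  leave : w 2 ≡ w 1 ℤ.+ + 1
  leave = forced-up {μ} (W 1) (sym second) λ same → marker≢non-marker (trans (sym same) (reads 0)) (reads 2)
  lands : w (suc (suc (gap k))) ≡ w 1 ℤ.+ + suc d
  lands = crossing {μ} k (λ i → W (suc i)) gp refl leave (λ i i<g → trans (reads _) (blocks-gap k i i<g))
            (trans (reads _) (proj₁ (blocks-next-pair k)))
  lands′ : w (suc (gap k) ℕ.+ 1) ≡ w (0 ℕ.+ 1) ℤ.+ + suc d
  lands′ = trans (cong w (ℕP.+-comm (suc (gap k)) 1)) lands
  enter : ∀ {e} → Gap μ (w 1) e → w (suc (suc (gap k))) ≡ w 1 ℤ.+ + suc e →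
    w (suc (suc (suc (gap k)))) ≡ w (suc (suc (gap k))) ℤ.+ + 1
  enter {zero} (_ , _ , at-end) _ = ⊥-elim (marker≢non-marker (trans (cong μ leave) at-end) (reads 2))
  enter {suc e} (_ , inside , _) lands = forced-up {μ} (W _) (trans (+-suc-step (w 1) (suc e)) (sym lands))
    λ same → marker≢non-marker (trans same (trans (reads _) (proj₂ (blocks-next-pair k))))
                               (inside e (ℕP.n<1+n e))

aligned-walk-is-identity : ∀ {μ f} k → Walk f → Follows μ +_ (blocks k) → Follows μ f (blocks k) →
  f 0 ≡ + 0 → f 1 ≡ + 1 → ∀ n → f n ≡ + n
aligned-walk-is-identity {μ} {f} k W labels reads f0 f1 n =
  walk-tight W f0 (proj₁ (aligned n)) (j≤blockStart k n)
  where
  aligned : ∀ j → f (blockStart k j) ≡ + blockStart k j × f (suc (blockStart k j)) ≡ + (blockStart k j ℕ.+ 1)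
  aligned zero = f0 , f1
  aligned (suc j) with aligned j
  ... | at-s , at-s+1 = at-next , at-next+1
    where
    open ≡-Reasoning
    s g : ℕ
    s = blockStart k j
    g = gap (k ℕ.+ j)
    reads′ : Follows μ (λ i → f (i ℕ.+ s)) (blocks (k ℕ.+ j))
    reads′ i = trans (reads (i ℕ.+ s)) (trans (cong (blocks k) (ℕP.+-comm i s)) (blocks-shift k j i))
    step : g ≤ g × f (suc (suc g) ℕ.+ s) ≡ f (1 ℕ.+ s) ℤ.+ + suc g
                 × f (suc (suc (suc g)) ℕ.+ s) ≡ f (suc (suc g) ℕ.+ s) ℤ.+ + 1
    step = block-step {μ} (k ℕ.+ j) (walk-shift W s) reads′ (trans at-s+1 (cong (ℤ._+ + 1) (sym at-s)))
             (subst (λ x → Gap μ x g) (sym at-s+1) (gap-after-pair {μ} k labels j))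
    comm : s ℕ.+ suc (suc g) ≡ suc (suc g) ℕ.+ s
    comm = ℕP.+-comm s (suc (suc g))
    at-next : f (s ℕ.+ suc (suc g)) ≡ + (s ℕ.+ suc (suc g))
    at-next = begin
      f (s ℕ.+ suc (suc g))        ≡⟨ cong f comm ⟩
      f (suc (suc g) ℕ.+ s)        ≡⟨ proj₁ (proj₂ step) ⟩
      f (1 ℕ.+ s) ℤ.+ + suc g      ≡⟨ cong (ℤ._+ + suc g) at-s+1 ⟩
      + ((s ℕ.+ 1) ℕ.+ suc g)      ≡⟨ cong +_ (ℕP.+-assoc s 1 (suc g)) ⟩
      + (s ℕ.+ suc (suc g))        ∎
    at-next+1 : f (suc (s ℕ.+ suc (suc g))) ≡ + ((s ℕ.+ suc (suc g)) ℕ.+ 1)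
    at-next+1 = begin
      f (suc (s ℕ.+ suc (suc g)))          ≡⟨ cong (f ∘ suc) comm ⟩
      f (suc (suc (suc g) ℕ.+ s))          ≡⟨ proj₂ (proj₂ step) ⟩
      f (suc (suc g) ℕ.+ s) ℤ.+ + 1        ≡⟨ cong (ℤ._+ + 1) (trans (cong f (sym comm)) at-next) ⟩
      + ((s ℕ.+ suc (suc g)) ℕ.+ 1)        ∎

-- Labels of ℤ: blocks a read upwards from 0 and blocks b read downwards from 1,
-- the pair {0, 1} being shared.
twoSided : ℕ → ℕ → ℤ → Bool
twoSided a b (+ n) = blocks a n
twoSided a b -[1+ n ] = blocks b (suc (suc n))

twoSided-reflect : ∀ a b x → twoSided a b (+ 1 ℤ.- x) ≡ twoSided b a x
twoSided-reflect a b (+ zero) = refl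
twoSided-reflect a b (+ suc zero) = refl
twoSided-reflect a b (+ suc (suc n)) = refl
twoSided-reflect a b -[1+ n ] = refl

gap-below-pair : ∀ a b j → Gap (twoSided a b) (ℤ.- + blockStart b (suc j) ℤ.+ + 1) (gap (b ℕ.+ j))
gap-below-pair a b j = subst (λ x → Gap (twoSided a b) x (gap (b ℕ.+ j))) position
  (gap-reflect {twoSided b a} {x = + (s ℕ.+ 1)} (+ 1) (λ z → sym (twoSided-reflect b a z))
    (gap-after-pair {twoSided b a} b (λ _ → refl) j))
  where
  s g : ℕ
  s = blockStart b j
  g = gap (b ℕ.+ j)
  position : + 1 ℤ.- (+ (s ℕ.+ 1) ℤ.+ + suc g) ≡ ℤ.- + (s ℕ.+ suc (suc g)) ℤ.+ + 1
  position = trans (cong (λ m → + 1 ℤ.- + m) (ℕP.+-assoc s 1 (suc g)))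
    (ℤP.+-comm (+ 1) (ℤ.- + (s ℕ.+ suc (suc g))))

PairWithGap : ℕ → ℕ → ℤ → Set
PairWithGap a b y =
    (∃[ j ] y ≡ + blockStart a j × Gap (twoSided a b) (y ℤ.+ + 1) (gap (a ℕ.+ j)))
  ⊎ (∃[ j ] y ≡ ℤ.- + blockStart b (suc j) × Gap (twoSided a b) (y ℤ.+ + 1) (gap (b ℕ.+ j)))

pair-gap : ∀ a b y → twoSided a b y ≡ true → twoSided a b (y ℤ.+ + 1) ≡ true → PairWithGap a b y
pair-gap a b (+ n) p q with blocks-pair a n p (trans (cong (blocks a) (ℕP.+-comm 1 n)) q)
... | j , refl = inj₁ (j , refl , gap-after-pair {twoSided a b} a (λ _ → refl) j)
pair-gap a b -[1+ zero ] () _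
pair-gap a b -[1+ suc n ] p q with blocks-pair b (suc (suc n)) q p
... | zero , ()
... | suc j , start = inj₂ (j , cong (ℤ.-_ ∘ +_) start ,
        subst (λ m → Gap (twoSided a b) (ℤ.- + m ℤ.+ + 1) (gap (b ℕ.+ j))) (sym start) (gap-below-pair a b j))

minimal-gap : ∀ m j → gap (m ℕ.+ j) ≤ gap 0 → m ≡ 0 × j ≡ 0
minimal-gap m j small = ℕP.m+n≡0⇒m≡0 m sum≡0 , ℕP.m+n≡0⇒n≡0 m sum≡0
  where
  sum≡0 : m ℕ.+ j ≡ 0
  sum≡0 = ℕP.n≤0⇒n≡0 (gap-cancel small)

-- f 0, f 1 is a pair followed by a gap of length at most gap 0, the shortest one; the
-- two alternatives are the pair {0, 1} on the a-side and the pair {-4, -3} on the b-side.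
ascending-start : ∀ a b {f} → Walk f → Follows (twoSided a b) f (blocks 0) → f 1 ≡ f 0 ℤ.+ + 1 →
  (a ≡ 0 × f 0 ≡ + 0) ⊎ (b ≡ 0 × f 0 ≡ -[1+ 3 ])
ascending-start a b {f} W reads up =
  start-pair (pair-gap a b (f 0) (reads 0) (subst (λ z → twoSided a b z ≡ true) up (reads 1)))
  where
  crossed : ∀ {d} → Gap (twoSided a b) (f 0 ℤ.+ + 1) d → d ≤ gap 0
  crossed gp = proj₁ (block-step {twoSided a b} 0 W reads up (subst (λ x → Gap (twoSided a b) x _) (sym up) gp))
  start-pair : PairWithGap a b (f 0) → (a ≡ 0 × f 0 ≡ + 0) ⊎ (b ≡ 0 × f 0 ≡ -[1+ 3 ])
  start-pair (inj₁ (j , start , gp)) with minimal-gap a j (crossed gp)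
  ... | a≡0 , j≡0 = inj₁ (a≡0 , trans start (cong (+_ ∘ blockStart a) j≡0))
  start-pair (inj₂ (j , start , gp)) with minimal-gap b j (crossed gp)
  ... | b≡0 , j≡0 = inj₂ (b≡0 , trans start (cong₂ (λ b j → ℤ.- + blockStart b (suc j)) b≡0 j≡0))

-- A descending start maps the first block 0, …, 5 onto 5, …, 0; the next gap read, of
-- length gap 1, would then have to cover the gap below 0, of length gap 2.
descending-start-impossible : ∀ {f} → Walk f → Follows (twoSided 0 2) f (blocks 0) → f 1 ℤ.+ + 1 ≡ f 0 → ⊥
descending-start-impossible {f} W reads down = from-start (ascending-start 2 0 W′ reads′ up)
  where
  g : ℕ → ℤ
  g i = + 1 ℤ.- f i
  W′ : Walk g
  W′ = walk-reflect W (+ 1)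
  reads′ : Follows (twoSided 2 0) g (blocks 0)
  reads′ n = trans (sym (twoSided-reflect 0 2 (g n)))
    (trans (cong (twoSided 0 2) (reflect-involutive (+ 1) (f n))) (reads n))
  up : g 1 ≡ g 0 ℤ.+ + 1
  up = sym (reflect-step (+ 1) (f 1) (f 0) down)
  from-start : (2 ≡ 0 × g 0 ≡ + 0) ⊎ (0 ≡ 0 × g 0 ≡ -[1+ 3 ]) → ⊥
  from-start (inj₁ (() , _))
  from-start (inj₂ (_ , g0)) = ℕP.<⇒≱ (ℕP.n<1+n 1) (gap-cancel crossed)
    where
    g1 : g 1 ≡ -[1+ 2 ]
    g1 = trans up (cong (ℤ._+ + 1) g0)
    first-block : gap 0 ≤ gap 0 × g 4 ≡ g 1 ℤ.+ + 3 × g 5 ≡ g 4 ℤ.+ + 1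
    first-block = block-step {twoSided 2 0} 0 W′ reads′ up
      (subst (λ x → Gap (twoSided 2 0) x (gap 0)) (sym g1) (gap-below-pair 2 0 0))
    g4 : g 4 ≡ + 0
    g4 = trans (proj₁ (proj₂ first-block)) (cong (ℤ._+ + 3) g1)
    g5 : g 5 ≡ + 1
    g5 = trans (proj₂ (proj₂ first-block)) (cong (ℤ._+ + 1) g4)
    reads″ : Follows (twoSided 2 0) (λ i → g (i ℕ.+ 4)) (blocks 1)
    reads″ i = trans (reads′ (i ℕ.+ 4)) (trans (cong (blocks 0) (ℕP.+-comm i 4)) (blocks-shift 0 1 i))
    crossed : gap 2 ≤ gap 1
    crossed = proj₁ (block-step {twoSided 2 0} 1 (walk-shift W′ 4) reads″ (trans g5 (cong (ℤ._+ + 1) (sym g4)))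
      (subst (λ x → Gap (twoSided 2 0) x (gap 2)) (sym g5) (gap-after-pair {twoSided 2 0} 2 (λ _ → refl) 0)))

pin : ∀ {f} → Walk f → Follows (twoSided 0 2) f (blocks 0) → f 0 ≡ + 0 × f 1 ≡ + 1
pin W reads with W 0
... | inj₂ down = ⊥-elim (descending-start-impossible W reads down)
... | inj₁ up with ascending-start 0 2 W reads (sym up)
...   | inj₁ (_ , f0) = f0 , trans (sym up) (cong (ℤ._+ + 1) f0)
...   | inj₂ (() , _)

bit : Bool → Fin 2
bit = Inverse.from 2↔Bool

bit-injective : ∀ {x y} → bit x ≡ bit y → x ≡ y
bit-injective {x} {y} eq =
  trans (sym (Inverse.strictlyInverseˡ 2↔Bool x))
    (trans (cong (Inverse.to 2↔Bool) eq) (Inverse.strictlyInverseˡ 2↔Bool y))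

ray-adj-walk : ∀ {a b} → RayAdj a b → ZAdj (+ a) (+ b)
ray-adj-walk {a} (inj₁ refl) = inj₁ (cong +_ (ℕP.+-comm a 1))
ray-adj-walk {b = b} (inj₂ refl) = inj₂ (cong +_ (ℕP.+-comm b 1))

ray-distinguishing : EndoDistinguishing Ray (bit ∘ blocks 0)
ray-distinguishing φ endo preserves v =
  ℤP.+-injective (aligned-walk-is-identity {twoSided 0 2} 0 W (λ _ → refl) reads f0 f1 v)
  where
  f : ℕ → ℤ
  f n = + φ n
  W : Walk f
  W n = ray-adj-walk (endo n (suc n) (inj₁ refl))
  reads : Follows (twoSided 0 2) f (blocks 0)
  reads n = bit-injective (preserves n)
  f0 : f 0 ≡ + 0
  f0 = proj₁ (pin W reads)
  f1 : f 1 ≡ + 1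
  f1 = proj₂ (pin W reads)

ℕ-walk : Walk +_
ℕ-walk n = inj₁ (cong +_ (ℕP.+-comm n 1))

endo-walk : ∀ {φ w} → IsEndomorphism DoubleRay φ → Walk w → Walk (φ ∘ w)
endo-walk endo W i = endo _ _ (W i)

-- Reflecting through 1/2 turns the restriction of φ to 1, 0, -1, … into a walk reading
-- blocks 2 that starts aligned.
double-ray-distinguishing : EndoDistinguishing DoubleRay (bit ∘ twoSided 0 2)
double-ray-distinguishing φ endo preserves = fixed
  where
  reads : ∀ x → twoSided 0 2 (φ x) ≡ twoSided 0 2 x
  reads x = bit-injective (preserves x)
  W : Walk (φ ∘ +_)
  W = endo-walk endo ℕ-walk
  start : φ (+ 0) ≡ + 0 × φ (+ 1) ≡ + 1
  start = pin W (reads ∘ +_)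
  positive : ∀ n → φ (+ n) ≡ + n
  positive = aligned-walk-is-identity {twoSided 0 2} 0 W (λ _ → refl) (reads ∘ +_) (proj₁ start) (proj₂ start)
  reflected : ℕ → ℤ
  reflected n = + 1 ℤ.- + n
  g : ℕ → ℤ
  g n = + 1 ℤ.- φ (reflected n)
  reads′ : Follows (twoSided 2 0) g (blocks 2)
  reads′ n = trans (sym (twoSided-reflect 0 2 (g n)))
    (trans (cong (twoSided 0 2) (reflect-involutive (+ 1) (φ (reflected n))))
      (trans (reads (reflected n)) (twoSided-reflect 0 2 (+ n))))
  negative : ∀ n → g n ≡ + n
  negative = aligned-walk-is-identity {twoSided 2 0} 2
    (walk-reflect (endo-walk endo (walk-reflect ℕ-walk (+ 1))) (+ 1)) (λ _ → refl) reads′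
    (cong (λ y → + 1 ℤ.- y) (positive 1)) (cong (λ y → + 1 ℤ.- y) (positive 0))
  fixed : ∀ x → φ x ≡ x
  fixed (+ n) = positive n
  fixed -[1+ n ] =
    trans (sym (reflect-involutive (+ 1) (φ -[1+ n ]))) (cong (λ y → + 1 ℤ.- y) (negative (suc (suc n))))

few-labels-not-distinguishing : ∀ G (v : V G) (σ : V G → V G) → IsEndomorphism G σ → σ v ≢ v →
  ∀ k → k < 2 → (c : V G → Fin k) → ¬ EndoDistinguishing G c
few-labels-not-distinguishing G v σ endo moved zero _ c _ with c v
... | ()
few-labels-not-distinguishing G v σ endo moved (suc zero) _ c distinguishing =
  moved (distinguishing σ endo (λ u → Fin1-unique (c (σ u)) (c u)) v)
  where
  Fin1-unique : ∀ (i j : Fin 1) → i ≡ j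
  Fin1-unique Fin.zero Fin.zero = refl
few-labels-not-distinguishing G v σ endo moved (suc (suc k)) (s≤s (s≤s ())) c

lemma12 : EndoDistNumberIs Ray 2 × EndoDistNumberIs DoubleRay 2
lemma12 =
  ((bit ∘ blocks 0 , ray-distinguishing) ,
   few-labels-not-distinguishing Ray 0 suc (λ _ _ → shift-ray) λ ()) ,
  ((bit ∘ twoSided 0 2 , double-ray-distinguishing) ,
   few-labels-not-distinguishing DoubleRay (+ 0) (ℤ._+ + 1) (λ _ _ → shift-double-ray) λ ())
  where
  shift-ray : ∀ {u v} → RayAdj u v → RayAdj (suc u) (suc v)
  shift-ray (inj₁ e) = inj₁ (cong suc e)
  shift-ray (inj₂ e) = inj₂ (cong suc e)
  shift-double-ray : ∀ {u v} → ZAdj u v → ZAdj (u ℤ.+ + 1) (v ℤ.+ + 1)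
  shift-double-ray (inj₁ e) = inj₁ (cong (ℤ._+ + 1) e)
  shift-double-ray (inj₂ e) = inj₂ (cong (ℤ._+ + 1) e)
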